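{- For every $I^*$ with $2\le I^*=o(n)$, there exists a family $F_{I^*}$ of (not necessarily monotone) Boolean functions $\{0,1\}^n\to\{0,1\}$ such that $I[f]\ge I^*$ for every $f\in F_{I^*}$, but any algorithm (with query access to the function) that distinguishes with probability at least $2/3$ between the dictatorship function $f(x)=x_1$ (which has $I[f]=1$) and a uniformly selected function in $F_{I^*}$ must perform $\Omega(n/I^*)$ queries.
   Context: For $x\in\{0,1\}^n$, $x^{(\oplus i)}$ denotes $x$ with its $i$-th bit flipped; the influence of $f:\{0,1\}^n\to\{0,1\}$ is $I[f]=\sum_{i=1}^n\Pr_x[f(x)\ne f(x^{(\oplus i)})]$ with $x$ uniform in $\{0,1\}^n$. -}

module Defs where

open import Data.Bool using (Bool; true; false; not; _≟_)
open import Data.Nat as ℕ using (ℕ; zero; suc; _⊔_; _^_)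
open import Data.Fin using (Fin)
open import Data.Nat.ListAction using (sum)
open import Data.Vec as Vec using (Vec; []; _∷_; lookup; updateAt; head)
open import Data.List as List using (List; []; _∷_; _++_; map; length; concatMap; filter; allFin)
open import Data.Integer using (+_)
open import Data.Rational using (ℚ; _/_; 0ℚ; _≤_; _*_)
open import Data.Product using (∃; _×_)
open import Relation.Binary.PropositionalEquality using (_≢_)
open import Relation.Nullary using (¬_)
open import Relation.Nullary.Decidable using (¬?)
open import Data.List.NonEmpty using (List⁺; toList)
open import Data.List.Relation.Unary.AllPairs using (AllPairs)

Cube : ℕ → Set
Cube n = Vec Bool n

BoolFun : ℕ → Set
BoolFun n = Cube n → Bool

allPoints : (n : ℕ) → List (Cube n)
allPoints zero = [] ∷ []
allPoints (suc n) = map (false ∷_) (allPoints n) ++ map (true ∷_) (allPoints n)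

flipBit : ∀ {n} → Fin n → Cube n → Cube n
flipBit i x = updateAt x i not

-- a / d as a rational (d is always nonzero where used; a zero denominator gives 0).
frac : ℕ → ℕ → ℚ
frac a zero = 0ℚ
frac a (suc d) = (+ a) / suc d

sensCount : ∀ {n} → BoolFun n → Fin n → ℕ
sensCount {n} f i = length (filter (λ x → ¬? (f x ≟ f (flipBit i x))) (allPoints n))

influence : ∀ {n} → BoolFun n → ℚ
influence {n} f = frac (sum (map (sensCount f) (allFin n))) (2 ^ n)

dictator : ∀ {n} → BoolFun (suc n)
dictator x = head x

-- Deterministic adaptive query algorithms (query access to the function) = decision trees.
-- query x t₀ t₁ queries the value f x and continues with t₀ if f x = 0, t₁ if f x = 1.
data DTree (n : ℕ) : Set where
  leaf  : Bool → DTree n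
  query : Cube n → DTree n → DTree n → DTree n

run : ∀ {n} → DTree n → BoolFun n → Bool
run (leaf b) f = b
run (query x t₀ t₁) f with f x
... | false = run t₀ f
... | true  = run t₁ f

depth : ∀ {n} → DTree n → ℕ
depth (leaf b) = 0
depth (query x t₀ t₁) = suc (depth t₀ ⊔ depth t₁)

-- A randomized query algorithm: a uniformly random choice (using its internal
-- random bits) among a nonempty finite list of deterministic decision trees.
RandAlg : ℕ → Set
RandAlg n = List⁺ (DTree n)

queries : ∀ {n} → RandAlg n → ℕ
queries A = List.foldr _⊔_ 0 (List.map depth (toList A))

countOut : ∀ {n} → Bool → RandAlg n → BoolFun n → ℕ
countOut b A f = length (filter (λ t → run t f ≟ b) (toList A))

probOut : ∀ {n} → Bool → RandAlg n → BoolFun n → ℚ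
probOut b A f = frac (countOut b A f) (length (toList A))

probOutFam : ∀ {n} → Bool → RandAlg n → List⁺ (BoolFun n) → ℚ
probOutFam b A F = frac (sum (map (countOut b A) (toList F))) (length (toList F) ℕ.* length (toList A))

twoThirds : ℚ
twoThirds = (+ 2) / 3

-- A distinguishes g from a uniform member of F with probability ≥ 2/3:
-- it answers "true" on g and "false" on a random f ∈ F, each with probability ≥ 2/3.
-- (The other orientation is obtained by negating the output, same query count.)
Distinguishes : ∀ {n} → RandAlg n → BoolFun n → List⁺ (BoolFun n) → Set
Distinguishes A g F = (twoThirds ≤ probOut true A g) × (twoThirds ≤ probOutFam false A F)

DiffFun : ∀ {n} → BoolFun n → BoolFun n → Set
DiffFun {n} f g = ∃ λ (x : Cube n) → f x ≢ g x

DistinctFam : ∀ {n} → List⁺ (BoolFun n) → Set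
DistinctFam F = AllPairs DiffFun (toList F)

Family : ℕ → Set
Family n = List⁺ (BoolFun n)

-- Fix a prefix length k. For a ∈ {0,1}^k, the function f_a agrees with the dictator x₁ except on the
-- subcube where x₂ … x_{k+1} = a, on which a parity of the remaining n − k bits is added. Every one of
-- these n − k coordinates has influence 2^{−k}, so I[f_a] ≥ (n − k)/2^k, which is ≥ I* as long as
-- 2^k I* ≤ n − k. The 2^k subcubes are disjoint, so each query point separates the dictator from at most
-- one f_a: a decision tree of depth q behaves differently on the dictator and on at most q members of
-- the family. Distinguishing with probability 2/3 on both sides therefore forces 2^k ≤ 3q, and taking
-- k maximal gives 2^k ≥ (n − k − 1)/(2 I*) with n − k − 1 ≥ (n + 1)/4, whence q ≥ (n + 1)/(24 I*).
module Submission where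

open import Defs

module _ where
  open import Data.Bool using (Bool; true; false; not; _xor_; _∧_; T; if_then_else_)
  open import Data.Bool.Properties using (xor-same; xor-comm; true-xor; not-involutive; T-≡; T-∧)
  import Data.Bool as Bool
  open import Data.Empty using (⊥-elim)
  open import Data.Fin using (Fin; toℕ) renaming (zero to fzero; suc to fsuc)
  open import Data.Fin.Properties using (toℕ<n)
  open import Data.List using (List; []; _∷_; _++_; map; foldr; length; filter; tabulate; allFin)
  open import Data.List.NonEmpty using (toList)
  open import Data.List.Properties using (map-++; map-∘; map-cong; length-++; length-map; map-tabulate)
  open import Data.List.Relation.Unary.All using (All; []; _∷_)
  import Data.List.Relation.Unary.All as All
  import Data.List.Relation.Unary.All.Properties as All
  open import Data.List.Relation.Unary.AllPairs using (AllPairs; []; _∷_)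
  import Data.List.Relation.Unary.AllPairs as AllPairs
  import Data.List.Relation.Unary.AllPairs.Properties as AllPairs
  open import Data.Nat using (ℕ; zero; suc; _+_; _*_; _∸_; _^_; _⊔_; _≤_; _<_; z≤n; s≤s; NonZero)
  open import Data.Nat.Properties
  open import Data.Nat.ListAction using (sum)
  open import Data.Nat.ListAction.Properties using (sum-++)
  open import Data.Product using (∃-syntax; _×_; _,_; proj₁)
  open import Data.Vec using ([]; _∷_; head; tail; updateAt; replicate)
  open import Data.Vec.Properties using (∷-injectiveʳ)
  open import Function using (_∘_; _$_; Equivalence)
  open import Relation.Binary.PropositionalEquality
  open import Relation.Nullary using (¬_; does; yes; no; contradiction)
  open import Relation.Nullary.Decidable using (¬?; map′)
  open import Relation.Unary using (Pred; Decidable)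
  open import Level using (Level)
  open import Data.Nat.Solver using (module +-*-Solver)
  open import Algebra.Properties.CommutativeSemigroup +-commutativeSemigroup using (interchange)

  𝟙 : Bool → ℕ
  𝟙 true  = 1
  𝟙 false = 0

  𝟙≤1 : ∀ b → 𝟙 b ≤ 1
  𝟙≤1 true  = ≤-refl
  𝟙≤1 false = z≤n

  count : {A : Set} → (A → Bool) → List A → ℕ
  count p xs = sum (map (𝟙 ∘ p) xs)

  sum-map-+ : {A : Set} (f g : A → ℕ) (xs : List A) →
              sum (map (λ x → f x + g x) xs) ≡ sum (map f xs) + sum (map g xs)
  sum-map-+ f g []       = refl
  sum-map-+ f g (x ∷ xs) = trans (cong (f x + g x +_) (sum-map-+ f g xs)) (interchange (f x) (g x) _ _)

  count-cong : {A : Set} {p q : A → Bool} → (∀ x → p x ≡ q x) → ∀ xs → count p xs ≡ count q xs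
  count-cong p≗q xs = cong sum (map-cong (cong 𝟙 ∘ p≗q) xs)

  count-++ : {A : Set} (p : A → Bool) (xs ys : List A) → count p (xs ++ ys) ≡ count p xs + count p ys
  count-++ p xs ys = trans (cong sum (map-++ (𝟙 ∘ p) xs ys)) (sum-++ (map (𝟙 ∘ p) xs) _)

  count-map : {A B : Set} (p : B → Bool) (f : A → B) (xs : List A) → count p (map f xs) ≡ count (p ∘ f) xs
  count-map p f xs = cong sum (sym (map-∘ xs))

  count-const : {A : Set} (b : Bool) (xs : List A) → count (λ _ → b) xs ≡ 𝟙 b * length xs
  count-const b []       = sym (*-zeroʳ (𝟙 b))
  count-const b (x ∷ xs) = trans (cong (𝟙 b +_) (count-const b xs)) (sym (*-suc (𝟙 b) (length xs)))

  count≤length : {A : Set} (p : A → Bool) (xs : List A) → count p xs ≤ length xs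
  count≤length p []       = z≤n
  count≤length p (x ∷ xs) = +-mono-≤ (𝟙≤1 (p x)) (count≤length p xs)

  count-subadditive : {A : Set} {p q r : A → Bool} → (∀ x → 𝟙 (p x) ≤ 𝟙 (q x) + 𝟙 (r x)) →
                      ∀ xs → count p xs ≤ count q xs + count r xs
  count-subadditive le []       = z≤n
  count-subadditive {q = q} {r} le (x ∷ xs) =
    ≤-trans (+-mono-≤ (le x) (count-subadditive le xs))
            (≤-reflexive (interchange (𝟙 (q x)) (𝟙 (r x)) (count q xs) (count r xs)))

  length-filter≡count : {A : Set} {ℓ : Level} {P : Pred A ℓ} (P? : Decidable P) (xs : List A) →
                        length (filter P? xs) ≡ count (λ x → does (P? x)) xs
  length-filter≡count P? []       = refl
  length-filter≡count P? (x ∷ xs) with does (P? x)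
  ... | true  = cong suc (length-filter≡count P? xs)
  ... | false = length-filter≡count P? xs

  sum-count-comm : {A B : Set} (R : A → B → Bool) (xs : List A) (ys : List B) →
                   sum (map (λ x → count (R x) ys) xs) ≡ sum (map (λ y → count (λ x → R x y) xs) ys)
  sum-count-comm R xs []       = count-const false xs
  sum-count-comm R xs (y ∷ ys) =
    trans (sum-map-+ (λ x → 𝟙 (R x y)) (λ x → count (R x) ys) xs)
          (cong (count (λ x → R x y) xs +_) (sum-count-comm R xs ys))

  count≤1 : {A : Set} (p : A → Bool) {xs : List A} → AllPairs _≢_ xs →
            (∀ {x y} → T (p x) → T (p y) → x ≡ y) → count p xs ≤ 1
  count≤1 p []                     unique = z≤n
  count≤1 p {x ∷ _} (x∉xs ∷ distinct) unique with p x in px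
  ... | false = count≤1 p distinct unique
  ... | true  = s≤s (≤-reflexive (none x∉xs))
    where
    none : ∀ {ys} → All (x ≢_) ys → count p ys ≡ 0
    none []                     = refl
    none {y ∷ _} (x≢y ∷ x∉ys) with p y in py
    ... | false = none x∉ys
    ... | true  = ⊥-elim (x≢y (unique (Equivalence.from T-≡ px) (Equivalence.from T-≡ py)))

  count-allPoints-suc : ∀ n (p : Cube (suc n) → Bool) →
    count p (allPoints (suc n)) ≡ count (p ∘ (false ∷_)) (allPoints n) + count (p ∘ (true ∷_)) (allPoints n)
  count-allPoints-suc n p =
    trans (count-++ p (map (false ∷_) (allPoints n)) (map (true ∷_) (allPoints n)))
          (cong₂ _+_ (count-map p (false ∷_) (allPoints n)) (count-map p (true ∷_) (allPoints n)))

  length-allPoints : ∀ n → length (allPoints n) ≡ 2 ^ n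
  length-allPoints zero    = refl
  length-allPoints (suc n) = begin
    length (map (false ∷_) (allPoints n) ++ map (true ∷_) (allPoints n))
      ≡⟨ length-++ (map (false ∷_) (allPoints n)) ⟩
    length (map (false ∷_) (allPoints n)) + length (map (true ∷_) (allPoints n))
      ≡⟨ cong₂ _+_ (length-map _ (allPoints n)) (length-map _ (allPoints n)) ⟩
    length (allPoints n) + length (allPoints n)
      ≡⟨ cong₂ _+_ (length-allPoints n) (trans (length-allPoints n) (sym (+-identityʳ _))) ⟩
    2 ^ suc n ∎
    where open ≡-Reasoning

  count-true-allPoints : ∀ n → count (λ _ → true) (allPoints n) ≡ 2 ^ n
  count-true-allPoints n = trans (count-const true (allPoints n)) (trans (*-identityˡ _) (length-allPoints n))

  allPoints-distinct : ∀ n → AllPairs _≢_ (allPoints n)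
  allPoints-distinct zero    = [] ∷ []
  allPoints-distinct (suc n) =
    AllPairs.++⁺ (extend false) (extend true)
                 (All.map⁺ (All.tabulate λ _ → All.map⁺ (All.tabulate λ _ → λ ())))
    where
    extend : ∀ b → AllPairs _≢_ (map (b ∷_) (allPoints n))
    extend b = AllPairs.map⁺ (AllPairs.map (λ x≢y → x≢y ∘ ∷-injectiveʳ) (allPoints-distinct n))

  -- Perturbed dictators

  hasPrefix : ∀ {k n} → Cube k → Cube n → Bool
  hasPrefix []          _           = true
  hasPrefix (false ∷ a) (false ∷ v) = hasPrefix a v
  hasPrefix (true ∷ a)  (true ∷ v)  = hasPrefix a v
  hasPrefix (_ ∷ _)     _           = false

  prefix-unique : ∀ {k n} (a b : Cube k) (v : Cube n) → T (hasPrefix a v) → T (hasPrefix b v) → a ≡ b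
  prefix-unique []          []          _           _  _  = refl
  prefix-unique (false ∷ a) (false ∷ b) (false ∷ v) pa pb = cong (false ∷_) (prefix-unique a b v pa pb)
  prefix-unique (true ∷ a)  (true ∷ b)  (true ∷ v)  pa pb = cong (true ∷_) (prefix-unique a b v pa pb)
  prefix-unique (false ∷ a) (true ∷ b)  (false ∷ v) pa ()
  prefix-unique (false ∷ a) (true ∷ b)  (true ∷ v)  () pb
  prefix-unique (true ∷ a)  (false ∷ b) (false ∷ v) () pb
  prefix-unique (true ∷ a)  (false ∷ b) (true ∷ v)  pa ()
  prefix-unique (false ∷ a) (_ ∷ b)     []          () pb
  prefix-unique (true ∷ a)  (_ ∷ b)     []          () pb

  parity : ∀ {n} → Cube n → Bool
  parity []      = false
  parity (c ∷ v) = c xor parity v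

  parityFrom : ∀ {n} → ℕ → Cube n → Bool
  parityFrom zero    v       = parity v
  parityFrom (suc k) []      = false
  parityFrom (suc k) (_ ∷ v) = parityFrom k v

  perturbedDictator : ∀ {k n} → Cube k → BoolFun (suc n)
  perturbedDictator {k} a x = head x xor (hasPrefix a (tail x) ∧ parityFrom k (tail x))

  perturbedDictators : ∀ k n → List (BoolFun (suc n))
  perturbedDictators k n = map perturbedDictator (allPoints k)

  length-perturbedDictators : ∀ k n → length (perturbedDictators k n) ≡ 2 ^ k
  length-perturbedDictators k n = trans (length-map perturbedDictator (allPoints k)) (length-allPoints k)

  oddExtension : ∀ {k} → Cube k → (n : ℕ) → Cube n
  oddExtension []      zero    = []
  oddExtension []      (suc n) = true ∷ replicate n false
  oddExtension (_ ∷ _) zero    = []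
  oddExtension (b ∷ a) (suc n) = b ∷ oddExtension a n

  hasPrefix-oddExtension : ∀ {k} (a : Cube k) n → k ≤ n → T (hasPrefix a (oddExtension a n))
  hasPrefix-oddExtension []          zero    _         = _
  hasPrefix-oddExtension []          (suc n) _         = _
  hasPrefix-oddExtension (false ∷ a) (suc n) (s≤s k≤n) = hasPrefix-oddExtension a n k≤n
  hasPrefix-oddExtension (true ∷ a)  (suc n) (s≤s k≤n) = hasPrefix-oddExtension a n k≤n

  parityFrom-oddExtension : ∀ {k} (a : Cube k) n → k < n → T (parityFrom k (oddExtension a n))
  parityFrom-oddExtension []      (suc n) _         = subst (T ∘ (true xor_)) (sym (parity-zeros n)) _
    where
    parity-zeros : ∀ n → parity (replicate n false) ≡ false
    parity-zeros zero    = refl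
    parity-zeros (suc n) = parity-zeros n
  parityFrom-oddExtension (b ∷ a) (suc n) (s≤s k<n) = parityFrom-oddExtension a n k<n

  perturbedDictator-distinct : ∀ {k n} (a b : Cube k) → k < n → a ≢ b →
                               DiffFun (perturbedDictator {k} {n} a) (perturbedDictator b)
  perturbedDictator-distinct {k} {n} a b k<n a≢b =
    false ∷ w , λ fa≡fb → a≢b (prefix-unique a b w has-a (proj₁ (Equivalence.to T-∧ (subst T fa≡fb fa))))
    where
    w : Cube n
    w = oddExtension a n
    has-a : T (hasPrefix a w)
    has-a = hasPrefix-oddExtension a n (<⇒≤ k<n)
    fa : T (perturbedDictator {k} {n} a (false ∷ w))
    fa = Equivalence.from T-∧ (has-a , parityFrom-oddExtension a n k<n)

  perturbedDictators-distinct : ∀ k n → k < n → AllPairs DiffFun (perturbedDictators k n)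
  perturbedDictators-distinct k n k<n =
    AllPairs.map⁺ (AllPairs.map (perturbedDictator-distinct _ _ k<n) (allPoints-distinct k))

  hasPrefix-flip : ∀ {k n} (a : Cube k) (v : Cube n) (j : Fin n) → k ≤ toℕ j →
                   hasPrefix a (updateAt v j not) ≡ hasPrefix a v
  hasPrefix-flip []          _           _        _         = refl
  hasPrefix-flip (false ∷ a) (false ∷ v) (fsuc j) (s≤s k≤j) = hasPrefix-flip a v j k≤j
  hasPrefix-flip (true ∷ a)  (true ∷ v)  (fsuc j) (s≤s k≤j) = hasPrefix-flip a v j k≤j
  hasPrefix-flip (false ∷ a) (true ∷ v)  (fsuc j) _         = refl
  hasPrefix-flip (true ∷ a)  (false ∷ v) (fsuc j) _         = refl

  parity-flip : ∀ {n} (v : Cube n) (j : Fin n) → parity (updateAt v j not) ≡ not (parity v)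
  parity-flip (false ∷ v) fzero    = refl
  parity-flip (true ∷ v)  fzero    = sym (not-involutive (parity v))
  parity-flip (false ∷ v) (fsuc j) = parity-flip v j
  parity-flip (true ∷ v)  (fsuc j) = cong not (parity-flip v j)

  parityFrom-flip : ∀ {n} k (v : Cube n) (j : Fin n) → k ≤ toℕ j →
                    parityFrom k (updateAt v j not) ≡ not (parityFrom k v)
  parityFrom-flip zero    v       j        _         = parity-flip v j
  parityFrom-flip (suc k) (_ ∷ v) (fsuc j) (s≤s k≤j) = parityFrom-flip k v j k≤j

  count-hasPrefix : ∀ {k} n (a : Cube k) → k ≤ n → count (hasPrefix a) (allPoints n) ≡ 2 ^ (n ∸ k)
  count-hasPrefix n       []          _         = count-true-allPoints n
  count-hasPrefix (suc n) (false ∷ a) (s≤s k≤n) =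
    trans (count-allPoints-suc n (hasPrefix (false ∷ a)))
          (trans (cong₂ _+_ (count-hasPrefix n a k≤n) (count-const false (allPoints n))) (+-identityʳ _))
  count-hasPrefix (suc n) (true ∷ a)  (s≤s k≤n) =
    trans (count-allPoints-suc n (hasPrefix (true ∷ a)))
          (cong₂ _+_ (count-const false (allPoints n)) (count-hasPrefix n a k≤n))

  sensCount≡count : ∀ {n} (f : BoolFun n) (i : Fin n) →
                    sensCount f i ≡ count (λ x → f x xor f (flipBit i x)) (allPoints n)
  sensCount≡count {n} f i =
    trans (length-filter≡count (λ x → ¬? (f x Bool.≟ f (flipBit i x))) (allPoints n))
          (count-cong (λ x → does-≢ (f x) (f (flipBit i x))) (allPoints n))
    where
    does-≢ : ∀ b c → does (¬? (b Bool.≟ c)) ≡ b xor c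
    does-≢ false false = refl
    does-≢ false true  = refl
    does-≢ true  false = refl
    does-≢ true  true  = refl

  -- Beyond the prefix, a flip toggles only the parity factor, so it changes f_a exactly where the prefix matches.
  sensCount-perturbedDictator : ∀ {k n} (a : Cube k) (j : Fin n) → k ≤ toℕ j →
    sensCount (perturbedDictator {k} {n} a) (fsuc j) ≡ 2 ^ (n ∸ k) + 2 ^ (n ∸ k)
  sensCount-perturbedDictator {k} {n} a j k≤j = begin
    sensCount f (fsuc j)
      ≡⟨ sensCount≡count f (fsuc j) ⟩
    count (λ x → f x xor f (flipBit (fsuc j) x)) (allPoints (suc n))
      ≡⟨ count-cong flip (allPoints (suc n)) ⟩
    count (hasPrefix a ∘ tail) (allPoints (suc n))
      ≡⟨ count-allPoints-suc n (hasPrefix a ∘ tail) ⟩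
    count (hasPrefix a) (allPoints n) + count (hasPrefix a) (allPoints n)
      ≡⟨ cong₂ _+_ half half ⟩
    2 ^ (n ∸ k) + 2 ^ (n ∸ k) ∎
    where
    open ≡-Reasoning
    f : BoolFun (suc n)
    f = perturbedDictator {k} {n} a
    half : count (hasPrefix a) (allPoints n) ≡ 2 ^ (n ∸ k)
    half = count-hasPrefix n a (≤-trans k≤j (<⇒≤ (toℕ<n j)))
    toggle : ∀ b m p → (b xor (m ∧ p)) xor (b xor (m ∧ not p)) ≡ m
    toggle false false _     = refl
    toggle false true  false = refl
    toggle false true  true  = refl
    toggle true  false _     = refl
    toggle true  true  false = refl
    toggle true  true  true  = refl
    flip : ∀ x → f x xor f (flipBit (fsuc j) x) ≡ hasPrefix a (tail x)
    flip (b ∷ v) rewrite hasPrefix-flip a v j k≤j | parityFrom-flip k v j k≤j =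
      toggle b (hasPrefix a v) (parityFrom k v)

  sum-tabulate-≥ : ∀ n k c (g : Fin n → ℕ) → (∀ j → k ≤ toℕ j → c ≤ g j) →
                   (n ∸ k) * c ≤ sum (tabulate g)
  sum-tabulate-≥ zero    k       c g g≥c = ≤-reflexive (cong (_* c) (0∸n≡0 k))
  sum-tabulate-≥ (suc n) zero    c g g≥c =
    +-mono-≤ (g≥c fzero z≤n) (sum-tabulate-≥ n zero c (g ∘ fsuc) (λ j _ → g≥c (fsuc j) z≤n))
  sum-tabulate-≥ (suc n) (suc k) c g g≥c =
    ≤-trans (sum-tabulate-≥ n k c (g ∘ fsuc) (λ j k≤j → g≥c (fsuc j) (s≤s k≤j)))
            (m≤n+m _ (g fzero))

  totalSensitivity-perturbedDictator : ∀ {k n} (a : Cube k) →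
    (n ∸ k) * (2 ^ (n ∸ k) + 2 ^ (n ∸ k)) ≤
    sum (map (sensCount (perturbedDictator {k} {n} a)) (allFin (suc n)))
  totalSensitivity-perturbedDictator {k} {n} a = begin
    (n ∸ k) * (2 ^ (n ∸ k) + 2 ^ (n ∸ k))
      ≤⟨ sum-tabulate-≥ n k _ (s ∘ fsuc) (λ j → ≤-reflexive ∘ sym ∘ sensCount-perturbedDictator a j) ⟩
    sum (tabulate (s ∘ fsuc))
      ≤⟨ m≤n+m _ (s fzero) ⟩
    s fzero + sum (tabulate (s ∘ fsuc))
      ≡⟨ cong (λ xs → s fzero + sum xs) (sym (map-tabulate fsuc s)) ⟩
    sum (map s (allFin (suc n))) ∎
    where
    open ≤-Reasoning
    s : Fin (suc n) → ℕ
    s = sensCount (perturbedDictator {k} {n} a)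

  -- Query lower bound

  record DisjointDisagreements {m} (g : BoolFun m) (fs : List (BoolFun m)) : Set where
    constructor disjoint
    field disagreements≤1 : (x : Cube m) → count (λ f → f x xor g x) fs ≤ 1
  open DisjointDisagreements

  perturbedDictators-disagreements≤1 : ∀ k n (x : Cube (suc n)) →
                                      count (λ f → f x xor dictator x) (perturbedDictators k n) ≤ 1
  perturbedDictators-disagreements≤1 k n (b ∷ v) = begin
    count (λ f → f (b ∷ v) xor b) (perturbedDictators k n)
      ≡⟨ count-map _ perturbedDictator (allPoints k) ⟩
    count (λ a → (b xor flipped a) xor b) (allPoints k)
      ≡⟨ count-cong (λ a → cancel b (flipped a)) (allPoints k) ⟩
    count flipped (allPoints k)
      ≤⟨ count≤1 flipped (allPoints-distinct k) unique ⟩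
    1 ∎
    where
    open ≤-Reasoning
    flipped : Cube k → Bool
    flipped a = hasPrefix a v ∧ parityFrom k v
    cancel : ∀ b m → (b xor m) xor b ≡ m
    cancel false false = refl
    cancel false true  = refl
    cancel true  false = refl
    cancel true  true  = refl
    unique : ∀ {a a′} → T (flipped a) → T (flipped a′) → a ≡ a′
    unique {a} {a′} fa fa′ =
      prefix-unique a a′ v (proj₁ (Equivalence.to T-∧ fa)) (proj₁ (Equivalence.to T-∧ fa′))

  perturbedDictators-disjoint : ∀ k n → DisjointDisagreements dictator (perturbedDictators k n)
  perturbedDictators-disjoint k n = disjoint (perturbedDictators-disagreements≤1 k n)

  -- A query either hits a point where f and g differ, or f answers like g and both runs take the same branch.
  query-disagreement : ∀ {m} (x : Cube m) (t₀ t₁ : DTree m) (f g : BoolFun m) →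
    𝟙 (run (query x t₀ t₁) f xor run (query x t₀ t₁) g) ≤
    𝟙 (f x xor g x) + 𝟙 (run (if g x then t₁ else t₀) f xor run (if g x then t₁ else t₀) g)
  query-disagreement x t₀ t₁ f g with f x | g x
  ... | false | false = ≤-refl
  ... | true  | true  = ≤-refl
  ... | false | true  = ≤-trans (𝟙≤1 _) (m≤m+n 1 _)
  ... | true  | false = ≤-trans (𝟙≤1 _) (m≤m+n 1 _)

  disagreements≤depth : ∀ {m} {g : BoolFun m} {fs} → DisjointDisagreements g fs →
                        ∀ t → count (λ f → run t f xor run t g) fs ≤ depth t
  disagreements≤depth {fs = fs} _ (leaf b) =
    ≤-reflexive (trans (count-cong (λ _ → xor-same b) fs) (count-const false fs))
  disagreements≤depth {g = g} {fs} dis (query x t₀ t₁) =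
    ≤-trans (count-subadditive (λ f → query-disagreement x t₀ t₁ f g) fs)
            (+-mono-≤ (disagreements≤1 dis x) (branch (g x)))
    where
    branch : ∀ b → count (λ f → run (if b then t₁ else t₀) f xor run (if b then t₁ else t₀) g) fs ≤
                   depth t₀ ⊔ depth t₁
    branch false = ≤-trans (disagreements≤depth dis t₀) (m≤m⊔n _ _)
    branch true  = ≤-trans (disagreements≤depth dis t₁) (m≤n⊔m _ _)

  rejections+acceptance≤ : ∀ {m} {g : BoolFun m} {fs} → DisjointDisagreements g fs → ∀ t →
    count (λ f → not (run t f)) fs + 𝟙 (run t g) * length fs ≤ length fs + depth t
  rejections+acceptance≤ {g = g} {fs} dis t with run t g in accepts
  ... | false = ≤-trans (≤-reflexive (+-identityʳ _)) (≤-trans (count≤length _ fs) (m≤m+n _ _))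
  ... | true  = begin
    count (λ f → not (run t f)) fs + 1 * length fs
      ≡⟨ cong (count (λ f → not (run t f)) fs +_) (*-identityˡ (length fs)) ⟩
    count (λ f → not (run t f)) fs + length fs
      ≡⟨ +-comm _ (length fs) ⟩
    length fs + count (λ f → not (run t f)) fs
      ≤⟨ +-monoʳ-≤ (length fs) rejections≤depth ⟩
    length fs + depth t ∎
    where
    open ≤-Reasoning
    rejection=disagreement : ∀ f → not (run t f) ≡ run t f xor run t g
    rejection=disagreement f =
      sym (trans (cong (run t f xor_) accepts) (trans (xor-comm (run t f) true) (true-xor _)))
    rejections≤depth : count (λ f → not (run t f)) fs ≤ depth t
    rejections≤depth =
      ≤-trans (≤-reflexive (count-cong rejection=disagreement fs)) (disagreements≤depth dis t)

  rejections+acceptances≤ : ∀ {m} {g : BoolFun m} {fs} → DisjointDisagreements g fs →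
    ∀ Q (ts : List (DTree m)) → All (λ t → depth t ≤ Q) ts →
    sum (map (λ t → count (λ f → not (run t f)) fs) ts) + count (λ t → run t g) ts * length fs ≤
    length ts * (length fs + Q)
  rejections+acceptances≤ _ Q [] [] = z≤n
  rejections+acceptances≤ {g = g} {fs} dis Q (t ∷ ts) (t≤Q ∷ ts≤Q) = begin
    (r + R) + (𝟙 (run t g) + A) * M    ≡⟨ cong ((r + R) +_) (*-distribʳ-+ M (𝟙 (run t g)) A) ⟩
    (r + R) + (𝟙 (run t g) * M + A * M) ≡⟨ interchange r R _ _ ⟩
    (r + 𝟙 (run t g) * M) + (R + A * M) ≤⟨ +-mono-≤ (≤-trans (rejections+acceptance≤ dis t) (+-monoʳ-≤ M t≤Q))
                                                     (rejections+acceptances≤ dis Q ts ts≤Q) ⟩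
    (M + Q) + length ts * (M + Q)       ∎
    where
    open ≤-Reasoning
    M r R A : ℕ
    M = length fs
    r = count (λ f → not (run t f)) fs
    R = sum (map (λ t → count (λ f → not (run t f)) fs) ts)
    A = count (λ t → run t g) ts

  countOut-true : ∀ {m} (A : RandAlg m) f → countOut true A f ≡ count (λ t → run t f) (toList A)
  countOut-true A f =
    trans (length-filter≡count _ (toList A)) (count-cong (λ t → does-≟-true (run t f)) (toList A))
    where
    does-≟-true : ∀ b → does (b Bool.≟ true) ≡ b
    does-≟-true false = refl
    does-≟-true true  = refl

  countOut-false : ∀ {m} (A : RandAlg m) f → countOut false A f ≡ count (λ t → not (run t f)) (toList A)
  countOut-false A f =
    trans (length-filter≡count _ (toList A)) (count-cong (λ t → does-≟-false (run t f)) (toList A))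
    where
    does-≟-false : ∀ b → does (b Bool.≟ false) ≡ not b
    does-≟-false false = refl
    does-≟-false true  = refl

  depth≤queries : ∀ {m} (A : RandAlg m) → All (λ t → depth t ≤ queries A) (toList A)
  depth≤queries A = go (toList A)
    where
    go : ∀ {m} (ts : List (DTree m)) → All (λ t → depth t ≤ foldr _⊔_ 0 (map depth ts)) ts
    go []       = []
    go (t ∷ ts) = m≤m⊔n (depth t) _ ∷ All.map (λ le → ≤-trans le (m≤n⊔m (depth t) _)) (go ts)

  -- Choosing the prefix length

  crossing : ∀ {ℓ} {P : ℕ → Set ℓ} → Decidable P → P 0 → ∀ n → ¬ P n →
             ∃[ k ] P k × ¬ P (suc k)
  crossing P? p0 zero    ¬pn = contradiction p0 ¬pn
  crossing P? p0 (suc n) ¬pn with P? n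
  ... | yes pn  = n , pn , ¬pn
  ... | no  ¬pn′ = crossing P? p0 n ¬pn′

  -- With I* = s / D, prefix length k is admissible when f_a keeps influence (n - k) / 2^k ≥ I*.
  record Admissible (s D n k : ℕ) : Set where
    constructor admissible
    field 2^k*s≤[n∸k]*D : 2 ^ k * s ≤ (n ∸ k) * D

  admissible? : ∀ s D n → Decidable (Admissible s D n)
  admissible? s D n k = map′ admissible Admissible.2^k*s≤[n∸k]*D (2 ^ k * s ≤? (n ∸ k) * D)

  admissible-zero : ∀ {s D n} → 2 * D ≤ s → s * 2 ≤ suc n * D → Admissible s D n 0
  admissible-zero {s} {D} {n} 2D≤s 2s≤[n+1]D = admissible $ *-cancelʳ-≤ (1 * s) (n * D) 2 (begin
    1 * s * 2      ≡⟨ solve 1 (λ s → con 1 :* s :* con 2 := s :* con 2) refl s ⟩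
    s * 2          ≤⟨ *-monoʳ-≤ s (s≤s (s≤s z≤n)) ⟩
    s * 3          ≤⟨ 3s≤2nD ⟩
    n * D * 2      ∎)
    where
    open ≤-Reasoning
    open +-*-Solver
    3s≤2nD : s * 3 ≤ n * D * 2
    3s≤2nD = +-cancelʳ-≤ s (s * 3) (n * D * 2) (begin
      s * 3 + s
        ≡⟨ solve 1 (λ s → s :* con 3 :+ s := s :* con 2 :* con 2) refl s ⟩
      s * 2 * 2
        ≤⟨ *-monoˡ-≤ 2 2s≤[n+1]D ⟩
      suc n * D * 2
        ≡⟨ solve 2 (λ n D → (con 1 :+ n) :* D :* con 2 := n :* D :* con 2 :+ con 2 :* D) refl n D ⟩
      n * D * 2 + 2 * D
        ≤⟨ +-monoʳ-≤ (n * D * 2) 2D≤s ⟩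
      n * D * 2 + s ∎)

  ¬admissible-self : ∀ {s D n} → 0 < s → ¬ Admissible s D n n
  ¬admissible-self {s} {D} {n} 0<s (admissible adm) =
    contradiction (≤-trans (*-mono-≤ (m^n>0 2 n) 0<s) (≤-trans adm (≤-reflexive (cong (_* D) (n∸n≡0 n)))))
                  λ ()

  admissible⇒influence : ∀ {s D n k} T → k ≤ n → Admissible s D n k →
                         (n ∸ k) * (2 ^ (n ∸ k) + 2 ^ (n ∸ k)) ≤ T → s * 2 ^ suc n ≤ T * D
  admissible⇒influence {s} {D} {n} {k} T k≤n (admissible adm) sens = begin
    s * 2 ^ suc n
      ≡⟨ cong (λ e → s * 2 ^ e) (sym k+[1+m]≡1+n) ⟩
    s * 2 ^ (k + suc m)
      ≡⟨ cong (s *_) (^-distribˡ-+-* 2 k (suc m)) ⟩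
    s * (2 ^ k * 2 ^ suc m)
      ≡⟨ solve 3 (λ s a b → s :* (a :* b) := (a :* s) :* b) refl s (2 ^ k) (2 ^ suc m) ⟩
    2 ^ k * s * 2 ^ suc m
      ≤⟨ *-monoˡ-≤ (2 ^ suc m) adm ⟩
    m * D * 2 ^ suc m
      ≡⟨ solve 3 (λ m D a → m :* D :* (a :+ (a :+ con 0)) := m :* (a :+ a) :* D) refl m D (2 ^ m) ⟩
    m * (2 ^ m + 2 ^ m) * D
      ≤⟨ *-monoˡ-≤ D sens ⟩
    T * D ∎
    where
    open ≤-Reasoning
    open +-*-Solver
    m : ℕ
    m = n ∸ k
    k+[1+m]≡1+n : k + suc m ≡ suc n
    k+[1+m]≡1+n = trans (+-suc k m) (cong suc (m+[n∸m]≡n k≤n))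

  n<2^n : ∀ n → n < 2 ^ n
  n<2^n zero    = s≤s z≤n
  n<2^n (suc n) = +-mono-≤ (m^n>0 2 n) (≤-trans (n<2^n n) (m≤m+n _ 0))

  admissible⇒2[k+1]≤n∸k : ∀ {s D n k} .{{_ : NonZero D}} → 2 * D ≤ s → Admissible s D n k →
                          2 * suc k ≤ n ∸ k
  admissible⇒2[k+1]≤n∸k {s} {D} {n} {k} 2D≤s (admissible adm) = begin
    2 * suc k       ≤⟨ *-monoʳ-≤ 2 (n<2^n k) ⟩
    2 * 2 ^ k       ≡⟨ *-comm 2 (2 ^ k) ⟩
    2 ^ k * 2       ≤⟨ *-cancelʳ-≤ (2 ^ k * 2) (n ∸ k) D 2^k*2*D≤[n∸k]*D ⟩
    n ∸ k           ∎
    where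
    open ≤-Reasoning
    2^k*2*D≤[n∸k]*D : 2 ^ k * 2 * D ≤ (n ∸ k) * D
    2^k*2*D≤[n∸k]*D = begin
      2 ^ k * 2 * D   ≡⟨ *-assoc (2 ^ k) 2 D ⟩
      2 ^ k * (2 * D) ≤⟨ *-monoʳ-≤ (2 ^ k) 2D≤s ⟩
      2 ^ k * s       ≤⟨ adm ⟩
      (n ∸ k) * D     ∎

  admissible⇒k<n : ∀ {s D n k} .{{_ : NonZero D}} → 2 * D ≤ s → Admissible s D n k → k < n
  admissible⇒k<n {s} {D} {n} {k} 2D≤s adm =
    m∸n≢0⇒n<m λ n∸k≡0 →
      contradiction (≤-trans (admissible⇒2[k+1]≤n∸k 2D≤s adm) (≤-reflexive n∸k≡0)) λ ()

  admissible⇒3k+2≤n : ∀ {s D n k} .{{_ : NonZero D}} → 2 * D ≤ s → Admissible s D n k → 3 * k + 2 ≤ n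
  admissible⇒3k+2≤n {s} {D} {n} {k} 2D≤s adm = begin
    3 * k + 2       ≡⟨ solve 1 (λ k → con 3 :* k :+ con 2 := con 2 :* (con 1 :+ k) :+ k) refl k ⟩
    2 * suc k + k   ≤⟨ +-monoˡ-≤ k (admissible⇒2[k+1]≤n∸k 2D≤s adm) ⟩
    (n ∸ k) + k     ≡⟨ m∸n+n≡m (<⇒≤ (admissible⇒k<n 2D≤s adm)) ⟩
    n               ∎
    where
    open ≤-Reasoning
    open +-*-Solver

  3k+2≤n⇒1+n≤4[n∸1+k] : ∀ {n k} → 3 * k + 2 ≤ n → suc n ≤ 4 * (n ∸ suc k)
  3k+2≤n⇒1+n≤4[n∸1+k] {n} {k} 3k+2≤n = begin
    suc n
      ≡⟨ cong suc n≡1+k+r ⟩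
    suc (suc k + r)
      ≤⟨ m≤m+n _ (5 * k + 1 + 3 * t) ⟩
    suc (suc k + r) + (5 * k + 1 + 3 * t)
      ≡⟨ solve 2 (λ k t → con 1 :+ (con 1 :+ k :+ (con 2 :* k :+ con 1 :+ t)) :+ (con 5 :* k :+ con 1 :+ con 3 :* t)
                          := con 4 :* (con 2 :* k :+ con 1 :+ t)) refl k t ⟩
    4 * r
      ≡⟨ cong (4 *_) (sym (m+n∸m≡n (suc k) r)) ⟩
    4 * (suc k + r ∸ suc k)
      ≡⟨ cong (λ m → 4 * (m ∸ suc k)) (sym n≡1+k+r) ⟩
    4 * (n ∸ suc k) ∎
    where
    open ≤-Reasoning
    open +-*-Solver
    t r : ℕ
    t = n ∸ (3 * k + 2)
    r = 2 * k + 1 + t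
    n≡1+k+r : n ≡ suc k + r
    n≡1+k+r = trans (sym (m+[n∸m]≡n 3k+2≤n))
                    (solve 2 (λ k t → con 3 :* k :+ con 2 :+ t := con 1 :+ k :+ (con 2 :* k :+ con 1 :+ t)) refl k t)

  -- Maximality of k: (n - k - 1) D < 2^{k+1} s, and n - k - 1 ≥ (n + 1) / 4.
  maximal-admissible⇒queries-bound : ∀ {s D n k Q} .{{_ : NonZero D}} → 2 * D ≤ s →
                                     Admissible s D n k → ¬ Admissible s D n (suc k) →
                                     2 ^ k ≤ 3 * Q → suc n * D ≤ Q * s * 24
  maximal-admissible⇒queries-bound {s} {D} {n} {k} {Q} 2D≤s adm ¬adm 2^k≤3Q = begin
    suc n * D
      ≤⟨ *-monoˡ-≤ D (3k+2≤n⇒1+n≤4[n∸1+k] (admissible⇒3k+2≤n 2D≤s adm)) ⟩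
    4 * (n ∸ suc k) * D
      ≡⟨ *-assoc 4 (n ∸ suc k) D ⟩
    4 * ((n ∸ suc k) * D)
      ≤⟨ *-monoʳ-≤ 4 (<⇒≤ (≰⇒> (¬adm ∘ admissible))) ⟩
    4 * (2 ^ suc k * s)
      ≡⟨ solve 2 (λ a s → con 4 :* ((con 2 :* a) :* s) := con 8 :* a :* s) refl (2 ^ k) s ⟩
    8 * 2 ^ k * s
      ≤⟨ *-monoˡ-≤ s (*-monoʳ-≤ 8 2^k≤3Q) ⟩
    8 * (3 * Q) * s
      ≡⟨ solve 2 (λ Q s → con 8 :* (con 3 :* Q) :* s := Q :* s :* con 24) refl Q s ⟩
    Q * s * 24 ∎
    where
    open ≤-Reasoning
    open +-*-Solver

  -- The algorithm accepts g with probability cT / L ≥ 2/3 and rejects a random member with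
  -- probability S / (M L) ≥ 2/3.
  success⇒size≤3*queries : ∀ {L M S cT Q} .{{_ : NonZero L}} → 2 * L ≤ cT * 3 → 2 * (M * L) ≤ S * 3 →
                           S + cT * M ≤ L * (M + Q) → M ≤ 3 * Q
  success⇒size≤3*queries {L} {M} {S} {cT} {Q} accept reject tradeoff =
    *-cancelʳ-≤ M (3 * Q) L (+-cancelʳ-≤ (3 * (M * L)) (M * L) (3 * Q * L) (begin
      M * L + 3 * (M * L)
        ≡⟨ solve 2 (λ M L → M :* L :+ con 3 :* (M :* L) := (con 2 :* L) :* M :+ con 2 :* (M :* L)) refl M L ⟩
      (2 * L) * M + 2 * (M * L)
        ≤⟨ +-mono-≤ (*-monoˡ-≤ M accept) reject ⟩
      (cT * 3) * M + S * 3
        ≡⟨ solve 3 (λ cT M S → (cT :* con 3) :* M :+ S :* con 3 := con 3 :* (S :+ cT :* M)) refl cT M S ⟩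
      3 * (S + cT * M)
        ≤⟨ *-monoʳ-≤ 3 tradeoff ⟩
      3 * (L * (M + Q))
        ≡⟨ solve 3 (λ L M Q → con 3 :* (L :* (M :+ Q)) := con 3 :* Q :* L :+ con 3 :* (M :* L)) refl L M Q ⟩
      3 * Q * L + 3 * (M * L) ∎))
    where
    open ≤-Reasoning
    open +-*-Solver

open import Data.Nat using (ℕ; suc; _≥_)
open import Data.Integer using (+_)
open import Data.Rational using (ℚ; _≤_; _<_; _*_; _/_; 0ℚ; mkℚ; *≤*; ↥_; ↧_)
open import Data.Product using (Σ; ∃; _×_; _,_; proj₁; proj₂)
open import Data.List.NonEmpty using (toList; List⁺; _∷_)
open import Data.List.Relation.Unary.All using (All)

import Data.Nat as ℕ
import Data.Nat.Properties as ℕP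
open import Data.Nat.ListAction using (sum)
open import Data.Bool using (true; false; not)
open import Data.List using (List; _∷_; map; length)
open import Data.List.Properties using (map-cong)
open import Data.List.Relation.Unary.AllPairs using (AllPairs)
import Data.List.Relation.Unary.All as All
import Data.List.Relation.Unary.All.Properties as All
import Data.Integer as ℤ
import Data.Integer.Properties as ℤP
open import Data.Integer.Solver using (module +-*-Solver)
open import Data.Integer.GCD using (gcd)
import Data.Rational.Properties as ℚP
import Data.Rational.Unnormalised as ℚᵘ
open import Function using (_⇔_; mk⇔; Equivalence)
open import Relation.Binary.PropositionalEquality

record IsFraction (p : ℚ) (a B : ℕ) : Set where
  constructor fraction
  field cross-multiplied : ↥ p ℤ.* + B ≡ + a ℤ.* ↧ p

isFraction-/ : ∀ a B .{{_ : ℕ.NonZero B}} → IsFraction ((+ a) / B) a B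
isFraction-/ a B = fraction (begin
  ↥ p ℤ.* + B             ≡⟨ cong (↥ p ℤ.*_) (sym (ℚP.↧-/ (+ a) B)) ⟩
  ↥ p ℤ.* (↧ p ℤ.* g)     ≡⟨ solve 3 (λ x y z → x :* (y :* z) := x :* z :* y) refl (↥ p) (↧ p) g ⟩
  ↥ p ℤ.* g ℤ.* ↧ p       ≡⟨ cong (ℤ._* ↧ p) (ℚP.↥-/ (+ a) B) ⟩
  + a ℤ.* ↧ p             ∎)
  where
  open ≡-Reasoning
  open +-*-Solver
  p : ℚ
  p = (+ a) / B
  g : ℤ.ℤ
  g = gcd (+ a) (+ B)

isFraction-frac : ∀ a B .{{_ : ℕ.NonZero B}} → IsFraction (frac a B) a B
isFraction-frac a (suc b) = isFraction-/ a (suc b)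

isFraction-* : ∀ {p q a b B D} → IsFraction p a B → IsFraction q b D →
               IsFraction (p * q) (a ℕ.* b) (B ℕ.* D)
isFraction-* {p@record{}} {q@record{}} {a} {b} {B} {D} (fraction p≐a/B) (fraction q≐b/D) =
  fraction (ℤP.*-cancelʳ-≡ _ _ (↧ p ℤ.* ↧ q) (begin
  ↥ pq ℤ.* + (B ℕ.* D) ℤ.* (↧ p ℤ.* ↧ q)
    ≡⟨ cong (λ z → ↥ pq ℤ.* z ℤ.* (↧ p ℤ.* ↧ q)) (ℤP.pos-* B D) ⟩
  ↥ pq ℤ.* (+ B ℤ.* + D) ℤ.* (↧ p ℤ.* ↧ q)
    ≡⟨ solve 5 (λ x y z u v → x :* (y :* z) :* (u :* v) := x :* (u :* v) :* (y :* z))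
               refl (↥ pq) (+ B) (+ D) (↧ p) (↧ q) ⟩
  ↥ pq ℤ.* (↧ p ℤ.* ↧ q) ℤ.* (+ B ℤ.* + D)
    ≡⟨ cong (ℤ._* (+ B ℤ.* + D)) ↥pq↧p↧q ⟩
  ↥ p ℤ.* ↥ q ℤ.* ↧ pq ℤ.* (+ B ℤ.* + D)
    ≡⟨ solve 5 (λ x y z u v → x :* y :* z :* (u :* v) := (x :* u) :* (y :* v) :* z)
               refl (↥ p) (↥ q) (↧ pq) (+ B) (+ D) ⟩
  (↥ p ℤ.* + B) ℤ.* (↥ q ℤ.* + D) ℤ.* ↧ pq
    ≡⟨ cong (ℤ._* ↧ pq) (cong₂ ℤ._*_ p≐a/B q≐b/D) ⟩
  (+ a ℤ.* ↧ p) ℤ.* (+ b ℤ.* ↧ q) ℤ.* ↧ pq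
    ≡⟨ solve 5 (λ x y z u v → (x :* u) :* (y :* v) :* z := x :* y :* z :* (u :* v))
               refl (+ a) (+ b) (↧ pq) (↧ p) (↧ q) ⟩
  + a ℤ.* + b ℤ.* ↧ pq ℤ.* (↧ p ℤ.* ↧ q)
    ≡⟨ cong (λ z → z ℤ.* ↧ pq ℤ.* (↧ p ℤ.* ↧ q)) (sym (ℤP.pos-* a b)) ⟩
  + (a ℕ.* b) ℤ.* ↧ pq ℤ.* (↧ p ℤ.* ↧ q) ∎))
  where
  open ≡-Reasoning
  open +-*-Solver
  pq : ℚ
  pq = p * q
  ↥pq↧p↧q : ↥ pq ℤ.* (↧ p ℤ.* ↧ q) ≡ ↥ p ℤ.* ↥ q ℤ.* ↧ pq
  ↥pq↧p↧q with ℚP.toℚᵘ-homo-* p q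
  ... | ℚᵘ.*≡* e = trans (cong (ℤ._* (↧ p ℤ.* ↧ q)) (sym (ℚP.↥ᵘ-toℚᵘ pq)))
                         (trans e (cong (↥ p ℤ.* ↥ q ℤ.*_) (ℚP.↧ᵘ-toℚᵘ pq)))

≤⇔cross : ∀ {p q a b B D} .{{_ : ℕ.NonZero B}} .{{_ : ℕ.NonZero D}} →
          IsFraction p a B → IsFraction q b D → p ≤ q ⇔ a ℕ.* D ℕ.≤ b ℕ.* B
≤⇔cross {p@record{}} {q@record{}} {a} {b} {B@(suc _)} {D@(suc _)} p≐a/B q≐b/D = mk⇔
  (λ p≤q → ℤP.drop‿+≤+ (ℤP.*-cancelʳ-≤-pos _ _ (↧ p ℤ.* ↧ q)
            (subst₂ ℤ._≤_ scaleˡ scaleʳ (ℤP.*-monoʳ-≤-nonNeg (+ (B ℕ.* D)) (ℚP.drop-*≤* p≤q)))))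
  (λ aD≤bB → *≤* (ℤP.*-cancelʳ-≤-pos _ _ (+ (B ℕ.* D))
            (subst₂ ℤ._≤_ (sym scaleˡ) (sym scaleʳ)
                    (ℤP.*-monoʳ-≤-nonNeg (↧ p ℤ.* ↧ q) (ℤ.+≤+ aD≤bB)))))
  where
  open ≡-Reasoning
  open +-*-Solver
  scale : ∀ x c X (y : ℚ) Y → IsFraction x c X →
          ↥ x ℤ.* ↧ y ℤ.* + (X ℕ.* Y) ≡ + (c ℕ.* Y) ℤ.* (↧ x ℤ.* ↧ y)
  scale x c X y Y (fraction x≐c/X) = begin
    ↥ x ℤ.* ↧ y ℤ.* + (X ℕ.* Y)
      ≡⟨ cong (↥ x ℤ.* ↧ y ℤ.*_) (ℤP.pos-* X Y) ⟩
    ↥ x ℤ.* ↧ y ℤ.* (+ X ℤ.* + Y)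
      ≡⟨ solve 4 (λ x y u v → x :* y :* (u :* v) := x :* u :* (y :* v)) refl (↥ x) (↧ y) (+ X) (+ Y) ⟩
    ↥ x ℤ.* + X ℤ.* (↧ y ℤ.* + Y)
      ≡⟨ cong (ℤ._* (↧ y ℤ.* + Y)) x≐c/X ⟩
    + c ℤ.* ↧ x ℤ.* (↧ y ℤ.* + Y)
      ≡⟨ solve 4 (λ x y u v → x :* y :* (u :* v) := x :* v :* (y :* u)) refl (+ c) (↧ x) (↧ y) (+ Y) ⟩
    + c ℤ.* + Y ℤ.* (↧ x ℤ.* ↧ y)
      ≡⟨ cong (ℤ._* (↧ x ℤ.* ↧ y)) (sym (ℤP.pos-* c Y)) ⟩
    + (c ℕ.* Y) ℤ.* (↧ x ℤ.* ↧ y) ∎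
  scaleˡ : ↥ p ℤ.* ↧ q ℤ.* + (B ℕ.* D) ≡ + (a ℕ.* D) ℤ.* (↧ p ℤ.* ↧ q)
  scaleˡ = scale p a B q D p≐a/B
  scaleʳ : ↥ q ℤ.* ↧ p ℤ.* + (B ℕ.* D) ≡ + (b ℕ.* B) ℤ.* (↧ p ℤ.* ↧ q)
  scaleʳ = trans (cong (λ z → ↥ q ℤ.* ↧ p ℤ.* + z) (ℕP.*-comm B D))
                 (trans (scale q b D p B q≐b/D) (cong (+ (b ℕ.* B) ℤ.*_) (ℤP.*-comm (↧ q) (↧ p))))

nonNegative⇒isFraction : ∀ {q} → 0ℚ ≤ q → ∃ λ s → ∃ λ d → IsFraction q s (suc d)
nonNegative⇒isFraction {mkℚ (+ s)      d _} _        = s , d , fraction refl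
nonNegative⇒isFraction {mkℚ ℤ.-[1+ _ ] _ _} (*≤* ())

perturbedDictators-influential : ∀ {I s D n k} .{{_ : ℕ.NonZero D}} → IsFraction I s D → k ℕ.≤ n →
                                 Admissible s D n k → All (λ f → I ≤ influence f) (perturbedDictators k n)
perturbedDictators-influential {I} {s} {D} {n} {k} I≐s/D k≤n adm =
  All.map⁺ (All.universal I≤influence (allPoints k))
  where
  instance
    2^[n+1]≢0 : ℕ.NonZero (2 ℕ.^ suc n)
    2^[n+1]≢0 = ℕP.m^n≢0 2 (suc n)
  I≤influence : (a : Cube k) → I ≤ influence (perturbedDictator {k} {n} a)
  I≤influence a = Equivalence.from (≤⇔cross I≐s/D (isFraction-frac _ (2 ℕ.^ suc n)))
    (admissible⇒influence _ k≤n adm (totalSensitivity-perturbedDictator a))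

queries-lowerBound : ∀ {m} (g : BoolFun m) (F : Family m) → DisjointDisagreements g (toList F) →
                     (A : RandAlg m) → Distinguishes A g F → length (toList F) ℕ.≤ 3 ℕ.* queries A
queries-lowerBound g F@(_ ∷ _) dis A@(_ ∷ _) (accept , reject) =
  success⇒size≤3*queries {S = rejected} {accepted} {queries A}
    (Equivalence.to (≤⇔cross (isFraction-/ 2 3) (isFraction-frac accepted L)) accept)
    (Equivalence.to (≤⇔cross (isFraction-/ 2 3) (isFraction-frac rejected (M ℕ.* L))) reject)
    (subst₂ (λ r a → r ℕ.+ a ℕ.* M ℕ.≤ L ℕ.* (M ℕ.+ queries A)) (sym rejected≡) (sym (countOut-true A g))
            (rejections+acceptances≤ dis (queries A) (toList A) (depth≤queries A)))
  where
  L M accepted rejected : ℕ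
  L = length (toList A)
  M = length (toList F)
  accepted = countOut true A g
  rejected = sum (map (countOut false A) (toList F))
  rejected≡ : rejected ≡ sum (map (λ t → count (λ f → not (run t f)) (toList F)) (toList A))
  rejected≡ = trans (cong sum (map-cong (countOut-false A) (toList F)))
                    (sum-count-comm (λ f t → not (run t f)) (toList F) (toList A))

fromNonEmpty : {A : Set} (xs : List A) → 0 ℕ.< length xs → List⁺ A
fromNonEmpty (x ∷ xs) _ = x ∷ xs

toList-fromNonEmpty : {A : Set} (xs : List A) (0<∣xs∣ : 0 ℕ.< length xs) →
                      toList (fromNonEmpty xs 0<∣xs∣) ≡ xs
toList-fromNonEmpty (x ∷ xs) _ = refl

HardFamily : ℕ → ℚ → Set
HardFamily n I =
  Σ (Family (suc n)) λ F →
    DistinctFam F ×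
    All (λ f → I ≤ influence f) (toList F) ×
    (∀ (A : RandAlg (suc n)) → Distinguishes A dictator F →
      ((+ 1) / 24) * ((+ suc n) / 1) ≤ ((+ queries A) / 1) * I)

hardFamily-fraction : ∀ {n I s D} .{{_ : ℕ.NonZero D}} → IsFraction I s D →
                      2 ℕ.* D ℕ.≤ s → s ℕ.* 2 ℕ.≤ suc n ℕ.* D → HardFamily n I
hardFamily-fraction {n} {I} {s} {D@(suc _)} I≐s/D 2D≤s 2s≤[n+1]D
  with crossing (admissible? s D n) (admissible-zero 2D≤s 2s≤[n+1]D)
                n (¬admissible-self (ℕP.≤-trans (ℕ.s≤s ℕ.z≤n) 2D≤s))
... | k , adm , ¬adm =
  F , subst (AllPairs DiffFun) (sym F≡) (perturbedDictators-distinct k n k<n) ,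
      subst (All (λ f → I ≤ influence f)) (sym F≡) (perturbedDictators-influential I≐s/D (ℕP.<⇒≤ k<n) adm) ,
      lowerBound
  where
  k<n : k ℕ.< n
  k<n = admissible⇒k<n 2D≤s adm
  F : Family (suc n)
  F = fromNonEmpty (perturbedDictators k n)
                   (ℕP.≤-trans (ℕP.m^n>0 2 k) (ℕP.≤-reflexive (sym (length-perturbedDictators k n))))
  F≡ : toList F ≡ perturbedDictators k n
  F≡ = toList-fromNonEmpty (perturbedDictators k n) _
  2^k≤3*queries : ∀ A → Distinguishes A dictator F → 2 ℕ.^ k ℕ.≤ 3 ℕ.* queries A
  2^k≤3*queries A distinguishes =
    subst (ℕ._≤ 3 ℕ.* queries A) (trans (cong length F≡) (length-perturbedDictators k n))
          (queries-lowerBound dictator F (subst (DisjointDisagreements dictator) (sym F≡) (perturbedDictators-disjoint k n))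
                              A distinguishes)
  lowerBound : ∀ (A : RandAlg (suc n)) → Distinguishes A dictator F →
               ((+ 1) / 24) * ((+ suc n) / 1) ≤ ((+ queries A) / 1) * I
  lowerBound A distinguishes =
    Equivalence.from (≤⇔cross (isFraction-* (isFraction-/ 1 24) (isFraction-/ (suc n) 1))
                              (isFraction-* (isFraction-/ (queries A) 1) I≐s/D))
      (ℕP.≤-trans (ℕP.≤-reflexive (cong₂ ℕ._*_ (ℕP.*-identityˡ (suc n)) (ℕP.*-identityˡ D)))
                  (maximal-admissible⇒queries-bound {Q = queries A} 2D≤s adm ¬adm (2^k≤3*queries A distinguishes)))

hardFamily : ∀ n {I} → (+ 2) / 1 ≤ I → I ≤ ((+ 1) / 2) * ((+ suc n) / 1) → HardFamily n I
hardFamily n {I} 2≤I I≤[n+1]/2 with nonNegative⇒isFraction (ℚP.≤-trans (ℚP.nonNegative⁻¹ _) 2≤I)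
... | s , d , I≐s/D = hardFamily-fraction I≐s/D 2D≤s 2s≤[n+1]D
  where
  2D≤s : 2 ℕ.* suc d ℕ.≤ s
  2D≤s = ℕP.≤-trans (Equivalence.to (≤⇔cross (isFraction-/ 2 1) I≐s/D) 2≤I)
                    (ℕP.≤-reflexive (ℕP.*-identityʳ s))
  2s≤[n+1]D : s ℕ.* 2 ℕ.≤ suc n ℕ.* suc d
  2s≤[n+1]D = ℕP.≤-trans (Equivalence.to (≤⇔cross I≐s/D (isFraction-* (isFraction-/ 1 2) (isFraction-/ (suc n) 1)))
                                         I≤[n+1]/2)
                         (ℕP.≤-reflexive (cong (ℕ._* suc d) (ℕP.*-identityˡ (suc n))))

mainTheorem4 :
    (Istar : ℕ → ℚ) →
    (∀ n → (+ 2) / 1 ≤ Istar n) →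
    (∀ (ε : ℚ) → 0ℚ < ε → ∃ λ N → ∀ n → n ≥ N → Istar n ≤ ε * ((+ n) / 1)) →
    ∃ λ (c : ℚ) → 0ℚ < c × (∃ λ N → ∀ n → n ≥ N →
      Σ (Family (suc n)) λ F →
        DistinctFam F ×
        All (λ f → Istar (suc n) ≤ influence f) (toList F) ×
        (∀ (A : RandAlg (suc n)) → Distinguishes A dictator F →
          c * ((+ suc n) / 1) ≤ ((+ queries A) / 1) * Istar (suc n)))
mainTheorem4 Istar Istar≥2 Istar=o[n] =
  (+ 1) / 24 , ℚP.positive⁻¹ _ , N , λ n n≥N →
    hardFamily n (Istar≥2 (suc n)) (Istar≤n/2 (suc n) (ℕP.m≤n⇒m≤1+n n≥N))
  where
  half-linear : ∃ λ N → ∀ n → n ≥ N → Istar n ≤ ((+ 1) / 2) * ((+ n) / 1)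
  half-linear = Istar=o[n] ((+ 1) / 2) (ℚP.positive⁻¹ _)
  N : ℕ
  N = proj₁ half-linear
  Istar≤n/2 : ∀ n → n ≥ N → Istar n ≤ ((+ 1) / 2) * ((+ n) / 1)
  Istar≤n/2 = proj₂ half-linear
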